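{- Let $u\in(\mathbb{Z}^2)^*$ be linearly independent of $(1,0)$, let $w,w'$ be positive integers and $r$ a rational number, and let $P=\{x\in\mathbb{R}^2 : (1,0)\cdot x\in[0,w],\ u\cdot x\in[r,r+w']\}$. Then every lattice polygon $Q\subseteq P$ is affine equivalent to a subset of $[0,w]\times[0,\max(w,w')]$.
   Context: A lattice polygon is a two-dimensional convex hull of finitely many points of $\mathbb{Z}^2$. Two subsets of $\mathbb{R}^2$ are affine equivalent if one is mapped onto the other by a map $x\mapsto Ax+c$ with $A\in\mathrm{GL}_2(\mathbb{Z})$ and $c\in\mathbb{Z}^2$.
   Formalization: The plane is taken as ℚ² in place of ℝ², so the polygon Q, the region P and the box $[0,w]\times[0,\max(w,w')]$ consist of their points with rational coordinates. -}

module Defs where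

open import Data.Nat using (ℕ)
open import Data.Integer as ℤ using (ℤ; +_)
open import Data.Rational as ℚ using (ℚ; 0ℚ; 1ℚ; _/_)
open import Data.Product using (_×_; _,_; proj₁; proj₂; Σ; ∃; ∃-syntax)
open import Data.List using (List; []; _∷_; map)
open import Data.List.Relation.Unary.All using (All)
open import Data.List.Membership.Propositional using (_∈_)
open import Relation.Binary.PropositionalEquality using (_≡_)
open import Relation.Nullary using (¬_)

ℤ² : Set
ℤ² = ℤ × ℤ

ℚ² : Set
ℚ² = ℚ × ℚ

ι : ℤ → ℚ
ι n = n / 1

embed : ℤ² → ℚ²
embed (a , b) = (ι a , ι b)

weightSum : List (ℚ × ℤ²) → ℚ
weightSum [] = 0ℚ
weightSum ((l , _) ∷ xs) = l ℚ.+ weightSum xs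

weightedPoint : List (ℚ × ℤ²) → ℚ²
weightedPoint [] = (0ℚ , 0ℚ)
weightedPoint ((l , (a , b)) ∷ xs) =
  let (s , t) = weightedPoint xs in (l ℚ.* ι a ℚ.+ s , l ℚ.* ι b ℚ.+ t)

-- x lies in the convex hull conv(S) of the finite set S of lattice points
-- (convex combination with nonnegative rational weights summing to 1)
InConv : List ℤ² → ℚ² → Set
InConv S x = ∃[ ws ] (All (λ lp → (0ℚ ℚ.≤ proj₁ lp) × (proj₂ lp ∈ S)) ws
                      × weightSum ws ≡ 1ℚ × weightedPoint ws ≡ x)

-- conv(S) is two-dimensional: S contains three affinely independent points
TwoDim : List ℤ² → Set
TwoDim S = ∃[ p ] ∃[ q ] ∃[ s ] (p ∈ S × q ∈ S × s ∈ S ×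
  ¬ (((proj₁ q ℤ.- proj₁ p) ℤ.* (proj₂ s ℤ.- proj₂ p)
      ℤ.- (proj₂ q ℤ.- proj₂ p) ℤ.* (proj₁ s ℤ.- proj₁ p)) ≡ + 0))

InP : ℤ² → ℕ → ℕ → ℚ → ℚ² → Set
InP (u₁ , u₂) w w' r (x₁ , x₂) =
  (0ℚ ℚ.≤ x₁) × (x₁ ℚ.≤ ι (+ w)) ×
  (r ℚ.≤ ι u₁ ℚ.* x₁ ℚ.+ ι u₂ ℚ.* x₂) × (ι u₁ ℚ.* x₁ ℚ.+ ι u₂ ℚ.* x₂ ℚ.≤ r ℚ.+ ι (+ w'))

InBox : ℕ → ℕ → ℚ² → Set
InBox a b (x₁ , x₂) = (0ℚ ℚ.≤ x₁) × (x₁ ℚ.≤ ι (+ a)) × (0ℚ ℚ.≤ x₂) × (x₂ ℚ.≤ ι (+ b))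

record Mat₂ : Set where
  constructor mat
  field a b c d : ℤ

det : Mat₂ → ℤ
det (mat a b c d) = a ℤ.* d ℤ.- b ℤ.* c

InGL₂ℤ : Mat₂ → Set
InGL₂ℤ M = (det M ≡ + 1) Data.Sum.⊎ (det M ≡ ℤ.- (+ 1))
  where import Data.Sum

affine : Mat₂ → ℤ² → ℚ² → ℚ²
affine (mat a b c d) (c₁ , c₂) (x₁ , x₂) =
  (ι a ℚ.* x₁ ℚ.+ ι b ℚ.* x₂ ℚ.+ ι c₁ , ι c ℚ.* x₁ ℚ.+ ι d ℚ.* x₂ ℚ.+ ι c₂)

-- Choose an integer k with |u₁ - k u₂| ≤ |u₂|/2 and apply the shear (x, y) ↦ (x, k x + y).
-- For lattice points s, t of Q with difference Δ,
--   u₂ (k Δ₁ + Δ₂) = u·Δ - (u₁ - k u₂) Δ₁,   |u·Δ| ≤ w',  |Δ₁| ≤ w,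
-- so |u₂| |k Δ₁ + Δ₂| ≤ w' + |u₂| w / 2, whence |k Δ₁ + Δ₂| ≤ max(w, w') (if |u₂| = 1 the
-- error term vanishes). Translating the least value of k x + y on S to 0 therefore puts S,
-- and with it the affine image of its convex hull Q, into [0,w] × [0,max(w,w')].

module Submission where

open import Defs
open import Data.Nat using (ℕ; NonZero; _⊔_)
open import Data.Integer using (ℤ; +_)
open import Data.Rational using (ℚ)
open import Data.List using (List)
open import Data.Product using (_×_; _,_; proj₁; proj₂; ∃-syntax)
open import Relation.Binary.PropositionalEquality using (_≡_)
open import Relation.Nullary using (¬_)

import Data.Nat as ℕ
open import Data.Nat using (zero; suc)
import Data.Nat.Properties as ℕP
open import Data.Nat.Coprimality as Coprime using (1-coprimeTo)
import Data.Integer as ℤ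
open import Data.Integer using (+[1+_]; -[1+_]; 0ℤ; 1ℤ; +≤+; ∣_∣)
import Data.Integer.Properties as ℤP
open import Data.Integer.DivMod using (_/ℕ_; _%ℕ_; a≡a%ℕn+[a/ℕn]*n; n%ℕd<d)
open import Data.Integer.Tactic.RingSolver using (solve-∀)
open import Data.Nat.Tactic.RingSolver using () renaming (solve-∀ to ℕ-solve-∀)
import Data.Rational as ℚ
open import Data.Rational using (mkℚ; 0ℚ; 1ℚ; toℚᵘ)
import Data.Rational.Properties as ℚP
open import Data.Rational.Solver using (module +-*-Solver)
open import Data.Rational.Unnormalised as ℚᵘ using (mkℚᵘ; *≡*)
import Data.Rational.Unnormalised.Properties as ℚᵘP
open import Data.List using ([]; _∷_)
open import Data.List.Relation.Unary.All as All using (All; lookup)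
open import Data.List.Membership.Propositional using (_∈_)
open import Data.List.Extrema ℤP.≤-totalOrder using (argmin; argmin-sel; f[argmin]≤f[xs])
open import Data.Sum using (inj₁; [_,_]′)
open import Function using (_∘_; const; id)
open import Relation.Binary.PropositionalEquality
  using (_≢_; refl; sym; trans; cong; cong₂; subst; subst₂; module ≡-Reasoning)
open import Relation.Nullary using (Dec; yes; no; contradiction)

ι≡mkℚ : ∀ a → ι a ≡ mkℚ a 0 (Coprime.sym (1-coprimeTo ∣ a ∣))
ι≡mkℚ a = ℚP.fromℚᵘ-toℚᵘ (mkℚ a 0 (Coprime.sym (1-coprimeTo ∣ a ∣)))

toℚᵘ-ι : ∀ a → toℚᵘ (ι a) ≡ mkℚᵘ a 0
toℚᵘ-ι a = cong toℚᵘ (ι≡mkℚ a)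

ι-homo-+ : ∀ a b → ι (a ℤ.+ b) ≡ ι a ℚ.+ ι b
ι-homo-+ a b = ℚP.toℚᵘ-injective (begin
  toℚᵘ (ι (a ℤ.+ b))              ≡⟨ toℚᵘ-ι (a ℤ.+ b) ⟩
  mkℚᵘ (a ℤ.+ b) 0                ≈⟨ *≡* (+-over-1 a b) ⟩
  mkℚᵘ a 0 ℚᵘ.+ mkℚᵘ b 0          ≡⟨ cong₂ ℚᵘ._+_ (toℚᵘ-ι a) (toℚᵘ-ι b) ⟨
  toℚᵘ (ι a) ℚᵘ.+ toℚᵘ (ι b)      ≈⟨ ℚP.toℚᵘ-homo-+ (ι a) (ι b) ⟨
  toℚᵘ (ι a ℚ.+ ι b)              ∎)
  where
  open ℚᵘP.≃-Reasoning
  +-over-1 : ∀ a b → (a ℤ.+ b) ℤ.* 1ℤ ≡ (a ℤ.* 1ℤ ℤ.+ b ℤ.* 1ℤ) ℤ.* 1ℤ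
  +-over-1 = solve-∀

ι-homo-* : ∀ a b → ι (a ℤ.* b) ≡ ι a ℚ.* ι b
ι-homo-* a b = ℚP.toℚᵘ-injective (begin
  toℚᵘ (ι (a ℤ.* b))              ≡⟨ toℚᵘ-ι (a ℤ.* b) ⟩
  mkℚᵘ a 0 ℚᵘ.* mkℚᵘ b 0          ≡⟨ cong₂ ℚᵘ._*_ (toℚᵘ-ι a) (toℚᵘ-ι b) ⟨
  toℚᵘ (ι a) ℚᵘ.* toℚᵘ (ι b)      ≈⟨ ℚP.toℚᵘ-homo-* (ι a) (ι b) ⟨
  toℚᵘ (ι a ℚ.* ι b)              ∎)
  where open ℚᵘP.≃-Reasoning

ι-mono-≤ : ∀ {a b} → a ℤ.≤ b → ι a ℚ.≤ ι b
ι-mono-≤ {a} {b} a≤b =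
  subst₂ ℚ._≤_ (sym (ι≡mkℚ a)) (sym (ι≡mkℚ b)) (ℚ.*≤* (ℤP.*-monoʳ-≤-nonNeg 1ℤ a≤b))

ι-cancel-≤ : ∀ {a b} → ι a ℚ.≤ ι b → a ℤ.≤ b
ι-cancel-≤ {a} {b} ιa≤ιb with subst₂ ℚ._≤_ (ι≡mkℚ a) (ι≡mkℚ b) ιa≤ιb
... | ℚ.*≤* a*1≤b*1 = subst₂ ℤ._≤_ (ℤP.*-identityʳ a) (ℤP.*-identityʳ b) a*1≤b*1

affineForm : ℚ → ℚ → ℚ → ℚ² → ℚ
affineForm α β γ (x₁ , x₂) = α ℚ.* x₁ ℚ.+ β ℚ.* x₂ ℚ.+ γ

weightedValue : (ℤ² → ℚ) → List (ℚ × ℤ²) → ℚ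
weightedValue f [] = 0ℚ
weightedValue f ((l , p) ∷ ws) = l ℚ.* f p ℚ.+ weightedValue f ws

WeightsOn : List ℤ² → List (ℚ × ℤ²) → Set
WeightsOn S = All (λ lp → (0ℚ ℚ.≤ proj₁ lp) × (proj₂ lp ∈ S))

affineForm-homogenised : ∀ α β γ ws →
  α ℚ.* proj₁ (weightedPoint ws) ℚ.+ β ℚ.* proj₂ (weightedPoint ws) ℚ.+ γ ℚ.* weightSum ws
    ≡ weightedValue (affineForm α β γ ∘ embed) ws
affineForm-homogenised α β γ [] =
  solve 3 (λ α β γ → α :* con 0ℚ :+ β :* con 0ℚ :+ γ :* con 0ℚ := con 0ℚ) refl α β γ
  where open +-*-Solver
affineForm-homogenised α β γ ((l , (a , b)) ∷ ws) = begin
  α ℚ.* (l ℚ.* ι a ℚ.+ X) ℚ.+ β ℚ.* (l ℚ.* ι b ℚ.+ Y) ℚ.+ γ ℚ.* (l ℚ.+ W)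
    ≡⟨ distribute α β γ l (ι a) (ι b) X Y W ⟩
  l ℚ.* affineForm α β γ (ι a , ι b) ℚ.+ (α ℚ.* X ℚ.+ β ℚ.* Y ℚ.+ γ ℚ.* W)
    ≡⟨ cong (l ℚ.* affineForm α β γ (ι a , ι b) ℚ.+_) (affineForm-homogenised α β γ ws) ⟩
  weightedValue (affineForm α β γ ∘ embed) ((l , (a , b)) ∷ ws) ∎
  where
  open ≡-Reasoning
  open +-*-Solver
  X = proj₁ (weightedPoint ws)
  Y = proj₂ (weightedPoint ws)
  W = weightSum ws
  distribute : ∀ α β γ l A B X Y W →
    α ℚ.* (l ℚ.* A ℚ.+ X) ℚ.+ β ℚ.* (l ℚ.* B ℚ.+ Y) ℚ.+ γ ℚ.* (l ℚ.+ W)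
      ≡ l ℚ.* (α ℚ.* A ℚ.+ β ℚ.* B ℚ.+ γ) ℚ.+ (α ℚ.* X ℚ.+ β ℚ.* Y ℚ.+ γ ℚ.* W)
  distribute = solve 9 (λ α β γ l A B X Y W →
    α :* (l :* A :+ X) :+ β :* (l :* B :+ Y) :+ γ :* (l :+ W)
      := l :* (α :* A :+ β :* B :+ γ) :+ (α :* X :+ β :* Y :+ γ :* W)) refl

affineForm-weightedPoint : ∀ α β γ ws → weightSum ws ≡ 1ℚ →
  affineForm α β γ (weightedPoint ws) ≡ weightedValue (affineForm α β γ ∘ embed) ws
affineForm-weightedPoint α β γ ws Σws≡1 = trans
  (cong (α ℚ.* proj₁ (weightedPoint ws) ℚ.+ β ℚ.* proj₂ (weightedPoint ws) ℚ.+_) γ≡γ*Σws)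
  (affineForm-homogenised α β γ ws)
  where
  γ≡γ*Σws : γ ≡ γ ℚ.* weightSum ws
  γ≡γ*Σws = sym (trans (cong (γ ℚ.*_) Σws≡1) (ℚP.*-identityʳ γ))

weightedValue-mono-≤ : ∀ {S f g} ws → WeightsOn S ws → (∀ {s} → s ∈ S → f s ℚ.≤ g s) →
  weightedValue f ws ℚ.≤ weightedValue g ws
weightedValue-mono-≤ [] All.[] _ = ℚP.≤-refl
weightedValue-mono-≤ ((l , p) ∷ ws) ((0≤l , p∈S) All.∷ ws-on-S) f≤g = ℚP.+-mono-≤
  (ℚP.*-monoˡ-≤-nonNeg l {{ℚ.nonNegative 0≤l}} (f≤g p∈S))
  (weightedValue-mono-≤ ws ws-on-S f≤g)

weightedValue-const : ∀ c ws → weightedValue (const c) ws ≡ c ℚ.* weightSum ws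
weightedValue-const c [] = sym (ℚP.*-zeroʳ c)
weightedValue-const c ((l , _) ∷ ws) = begin
  l ℚ.* c ℚ.+ weightedValue (const c) ws   ≡⟨ cong (l ℚ.* c ℚ.+_) (weightedValue-const c ws) ⟩
  l ℚ.* c ℚ.+ c ℚ.* weightSum ws           ≡⟨ cong (ℚ._+ c ℚ.* weightSum ws) (ℚP.*-comm l c) ⟩
  c ℚ.* l ℚ.+ c ℚ.* weightSum ws           ≡⟨ ℚP.*-distribˡ-+ c l (weightSum ws) ⟨
  c ℚ.* (l ℚ.+ weightSum ws)               ∎
  where open ≡-Reasoning

affineForm-bounded-on-conv : ∀ {S} α β γ L K →
  (∀ {s} → s ∈ S → (L ℚ.≤ affineForm α β γ (embed s)) × (affineForm α β γ (embed s) ℚ.≤ K)) →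
  ∀ {x} → InConv S x → (L ℚ.≤ affineForm α β γ x) × (affineForm α β γ x ℚ.≤ K)
affineForm-bounded-on-conv α β γ L K bounded (ws , ws-on-S , Σws≡1 , refl) =
  subst₂ ℚ._≤_ (constant L) φ-value (weightedValue-mono-≤ ws ws-on-S (proj₁ ∘ bounded)) ,
  subst₂ ℚ._≤_ φ-value (constant K) (weightedValue-mono-≤ ws ws-on-S (proj₂ ∘ bounded))
  where
  φ-value : weightedValue (affineForm α β γ ∘ embed) ws ≡ affineForm α β γ (weightedPoint ws)
  φ-value = sym (affineForm-weightedPoint α β γ ws Σws≡1)
  constant : ∀ c → weightedValue (const c) ws ≡ c
  constant c = trans (weightedValue-const c ws) (trans (cong (c ℚ.*_) Σws≡1) (ℚP.*-identityʳ c))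

embed-∈-conv : ∀ {S s} → s ∈ S → InConv S (embed s)
embed-∈-conv {s = a , b} s∈S =
  (1ℚ , (a , b)) ∷ [] , (ℚP.nonNegative⁻¹ 1ℚ , s∈S) All.∷ All.[] , refl ,
  cong₂ _,_ (one-times (ι a)) (one-times (ι b))
  where
  one-times : ∀ q → 1ℚ ℚ.* q ℚ.+ 0ℚ ≡ q
  one-times q = trans (ℚP.+-identityʳ _) (ℚP.*-identityˡ q)

infix 7 _·_

_·_ : ℤ² → ℤ² → ℤ
(u₁ , u₂) · (a , b) = u₁ ℤ.* a ℤ.+ u₂ ℤ.* b

ι-homo-· : ∀ u₁ u₂ s → ι ((u₁ , u₂) · s) ≡ ι u₁ ℚ.* proj₁ (embed s) ℚ.+ ι u₂ ℚ.* proj₂ (embed s)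
ι-homo-· u₁ u₂ (a , b) = trans (ι-homo-+ (u₁ ℤ.* a) (u₂ ℤ.* b)) (cong₂ ℚ._+_ (ι-homo-* u₁ a) (ι-homo-* u₂ b))

integralForm-bounded-on-conv : ∀ {S} α₁ α₂ γ L K →
  (∀ {s} → s ∈ S → (L ℤ.≤ (α₁ , α₂) · s ℤ.+ γ) × ((α₁ , α₂) · s ℤ.+ γ ℤ.≤ K)) →
  ∀ {x} → InConv S x →
  (ι L ℚ.≤ affineForm (ι α₁) (ι α₂) (ι γ) x) × (affineForm (ι α₁) (ι α₂) (ι γ) x ℚ.≤ ι K)
integralForm-bounded-on-conv α₁ α₂ γ L K bounded =
  affineForm-bounded-on-conv (ι α₁) (ι α₂) (ι γ) (ι L) (ι K) λ {s} s∈S →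
    let (L≤φs , φs≤K) = bounded s∈S
    in subst (ι L ℚ.≤_) (ι-form s) (ι-mono-≤ L≤φs) , subst (ℚ._≤ ι K) (ι-form s) (ι-mono-≤ φs≤K)
  where
  ι-form : ∀ s → ι ((α₁ , α₂) · s ℤ.+ γ) ≡ affineForm (ι α₁) (ι α₂) (ι γ) (embed s)
  ι-form s = trans (ι-homo-+ ((α₁ , α₂) · s) γ) (cong (ℚ._+ ι γ) (ι-homo-· α₁ α₂ s))

nearestMultiple⁺ : ∀ v d .{{_ : ℕ.NonZero d}} → ∃[ k ] 2 ℕ.* ∣ v ℤ.- k ℤ.* + d ∣ ℕ.≤ d
nearestMultiple⁺ v d = choose (2 ℕ.* r ℕ.≤? d)
  where
  r = v %ℕ d
  q = v /ℕ d
  v≡r+qd : v ≡ + r ℤ.+ q ℤ.* + d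
  v≡r+qd = a≡a%ℕn+[a/ℕn]*n v d
  round-down : ∀ r q d → r ℤ.+ q ℤ.* d ℤ.- q ℤ.* d ≡ r
  round-down = solve-∀
  round-up : ∀ r q d → r ℤ.+ q ℤ.* d ℤ.- (q ℤ.+ 1ℤ) ℤ.* d ≡ r ℤ.- d
  round-up = solve-∀
  error : ∀ k → v ℤ.- k ℤ.* + d ≡ + r ℤ.+ q ℤ.* + d ℤ.- k ℤ.* + d
  error k = cong (ℤ._- k ℤ.* + d) v≡r+qd
  choose : Dec (2 ℕ.* r ℕ.≤ d) → ∃[ k ] 2 ℕ.* ∣ v ℤ.- k ℤ.* + d ∣ ℕ.≤ d
  choose (yes 2r≤d) = q , subst (λ e → 2 ℕ.* ∣ e ∣ ℕ.≤ d) (sym (trans (error q) (round-down (+ r) q (+ d)))) 2r≤d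
  choose (no 2r≰d) = q ℤ.+ 1ℤ , (begin
    2 ℕ.* ∣ v ℤ.- (q ℤ.+ 1ℤ) ℤ.* + d ∣  ≡⟨ cong (λ e → 2 ℕ.* ∣ e ∣) (trans (error (q ℤ.+ 1ℤ)) (round-up (+ r) q (+ d))) ⟩
    2 ℕ.* ∣ + r ℤ.- + d ∣               ≡⟨ cong (λ e → 2 ℕ.* ∣ e ∣) (ℤP.m-n≡m⊖n r d) ⟩
    2 ℕ.* ∣ r ℤ.⊖ d ∣                    ≡⟨ cong (2 ℕ.*_) (ℤP.∣⊖∣-≤ (ℕP.<⇒≤ (n%ℕd<d v d))) ⟩
    2 ℕ.* (d ℕ.∸ r)                     ≡⟨ ℕP.*-distribˡ-∸ 2 d r ⟩
    2 ℕ.* d ℕ.∸ 2 ℕ.* r                 ≤⟨ ℕP.m≤n+o⇒m∸n≤o (2 ℕ.* d) (2 ℕ.* r) 2d≤2r+d ⟩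
    d                                   ∎)
    where
    open ℕP.≤-Reasoning
    2d≤2r+d : 2 ℕ.* d ℕ.≤ 2 ℕ.* r ℕ.+ d
    2d≤2r+d = begin
      2 ℕ.* d        ≡⟨ cong (d ℕ.+_) (ℕP.+-identityʳ d) ⟩
      d ℕ.+ d        ≤⟨ ℕP.+-monoˡ-≤ d (ℕP.<⇒≤ (ℕP.≰⇒> 2r≰d)) ⟩
      2 ℕ.* r ℕ.+ d  ∎

nearestMultiple : ∀ v d → d ≢ 0ℤ → ∃[ k ] 2 ℕ.* ∣ v ℤ.- k ℤ.* d ∣ ℕ.≤ ∣ d ∣
nearestMultiple v (+ 0) d≢0 = contradiction refl d≢0
nearestMultiple v +[1+ n ] _ = nearestMultiple⁺ v (suc n)
nearestMultiple v -[1+ n ] _ =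
  let (k , near) = nearestMultiple⁺ v (suc n)
  in ℤ.- k , subst (λ e → 2 ℕ.* ∣ e ∣ ℕ.≤ suc n) (sym (negate-both v k +[1+ n ])) near
  where
  negate-both : ∀ v k d → v ℤ.- (ℤ.- k) ℤ.* (ℤ.- d) ≡ v ℤ.- k ℤ.* d
  negate-both = solve-∀

≤⊔-of-half-error : ∀ d a c w w' .{{_ : ℕ.NonZero d}} →
  2 ℕ.* a ℕ.≤ d → d ℕ.* c ℕ.≤ w' ℕ.+ a ℕ.* w → c ℕ.≤ w ⊔ w'
≤⊔-of-half-error 1 zero c w w' _ c≤w' = begin
  c          ≡⟨ ℕP.*-identityˡ c ⟨
  1 ℕ.* c    ≤⟨ c≤w' ⟩
  w' ℕ.+ 0   ≡⟨ ℕP.+-identityʳ w' ⟩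
  w'         ≤⟨ ℕP.m≤n⊔m w w' ⟩
  w ⊔ w'     ∎
  where open ℕP.≤-Reasoning
≤⊔-of-half-error 1 (suc a) c w w' 2a≤1 _
  with () ← ℕP.m+n≤o⇒n≤o a (ℕ.s≤s⁻¹ 2a≤1)
≤⊔-of-half-error d@(suc (suc _)) a c w w' 2a≤d dc≤w'+aw =
  ℕP.*-cancelˡ-≤ 2 (ℕP.*-cancelˡ-≤ d (begin
    d ℕ.* (2 ℕ.* c)             ≡⟨ swap d 2 c ⟩
    2 ℕ.* (d ℕ.* c)             ≤⟨ ℕP.*-monoʳ-≤ 2 dc≤w'+aw ⟩
    2 ℕ.* (w' ℕ.+ a ℕ.* w)      ≡⟨ distribute w' a w ⟩
    2 ℕ.* w' ℕ.+ 2 ℕ.* a ℕ.* w  ≤⟨ ℕP.+-mono-≤ (ℕP.*-monoˡ-≤ w' {2} {d} (ℕ.s≤s (ℕ.s≤s ℕ.z≤n))) (ℕP.*-monoˡ-≤ w 2a≤d) ⟩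
    d ℕ.* w' ℕ.+ d ℕ.* w        ≤⟨ ℕP.+-mono-≤ (ℕP.*-monoʳ-≤ d (ℕP.m≤n⊔m w w')) (ℕP.*-monoʳ-≤ d (ℕP.m≤m⊔n w w')) ⟩
    d ℕ.* M ℕ.+ d ℕ.* M         ≡⟨ double d M ⟩
    d ℕ.* (2 ℕ.* M)             ∎))
  where
  open ℕP.≤-Reasoning
  M = w ⊔ w'
  swap : ∀ d e c → d ℕ.* (e ℕ.* c) ≡ e ℕ.* (d ℕ.* c)
  swap = ℕ-solve-∀
  distribute : ∀ w' a w → 2 ℕ.* (w' ℕ.+ a ℕ.* w) ≡ 2 ℕ.* w' ℕ.+ 2 ℕ.* a ℕ.* w
  distribute = ℕ-solve-∀
  double : ∀ d M → d ℕ.* M ℕ.+ d ℕ.* M ≡ d ℕ.* (2 ℕ.* M)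
  double = ℕ-solve-∀

∣i-j∣≤-of-bounds : ∀ {i j w} → (0ℤ ℤ.≤ i) × (i ℤ.≤ + w) → (0ℤ ℤ.≤ j) × (j ℤ.≤ + w) →
  ∣ i ℤ.- j ∣ ℕ.≤ w
∣i-j∣≤-of-bounds {+ m} {+ n} (_ , +≤+ m≤w) (_ , +≤+ n≤w) =
  subst (ℕ._≤ _) (cong ∣_∣ (sym (ℤP.m-n≡m⊖n m n))) (ℕP.≤-trans (ℤP.∣m⊝n∣≤m⊔n m n) (ℕP.⊔-lub m≤w n≤w))

∣i-j∣≤ : ∀ {i j w} → i ℤ.≤ j ℤ.+ + w → j ℤ.≤ i ℤ.+ + w → ∣ i ℤ.- j ∣ ℕ.≤ w
∣i-j∣≤ {i} {j} {w} i≤j+w j≤i+w =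
  [ (λ j≤i → ordered j≤i i≤j+w)
  , (λ i≤j → subst (ℕ._≤ w) (ℤP.∣i-j∣≡∣j-i∣ j i) (ordered i≤j j≤i+w))
  ]′ (ℤP.≤-total j i)
  where
  cancel : ∀ j k → j ℤ.+ k ℤ.- j ≡ k
  cancel = solve-∀
  ordered : ∀ {i j} → j ℤ.≤ i → i ℤ.≤ j ℤ.+ + w → ∣ i ℤ.- j ∣ ℕ.≤ w
  ordered {i} {j} j≤i i≤j+w = ℤP.drop‿+≤+ (begin
    + ∣ i ℤ.- j ∣        ≡⟨ ℤP.0≤i⇒+∣i∣≡i (ℤP.i≤j⇒0≤j-i j≤i) ⟩
    i ℤ.- j              ≤⟨ ℤP.+-monoˡ-≤ (ℤ.- j) i≤j+w ⟩
    j ℤ.+ + w ℤ.- j      ≡⟨ cancel j (+ w) ⟩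
    + w                  ∎)
    where open ℤP.≤-Reasoning

stripWidth : ∀ u₁ u₂ k {w w'} s t .{{_ : ℤ.NonZero u₂}} →
  2 ℕ.* ∣ u₁ ℤ.- k ℤ.* u₂ ∣ ℕ.≤ ∣ u₂ ∣ →
  ∣ proj₁ s ℤ.- proj₁ t ∣ ℕ.≤ w →
  ∣ (u₁ , u₂) · s ℤ.- (u₁ , u₂) · t ∣ ℕ.≤ w' →
  ∣ (k , 1ℤ) · s ℤ.- (k , 1ℤ) · t ∣ ℕ.≤ w ⊔ w'
stripWidth u₁ u₂ k {w} {w'} s@(a₁ , b₁) t@(a₂ , b₂) near Δa≤w Δu≤w' =
  ≤⊔-of-half-error (∣ u₂ ∣) (∣ e ∣) (∣ Δf ∣) w w' near (begin
    ∣ u₂ ∣ ℕ.* ∣ Δf ∣               ≡⟨ ℤP.∣i*j∣≡∣i∣*∣j∣ u₂ Δf ⟨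
    ∣ u₂ ℤ.* Δf ∣                   ≡⟨ cong ∣_∣ (split u₁ u₂ k a₁ b₁ a₂ b₂) ⟩
    ∣ Δu ℤ.- e ℤ.* Δa ∣             ≤⟨ ℤP.∣i-j∣≤∣i∣+∣j∣ Δu (e ℤ.* Δa) ⟩
    ∣ Δu ∣ ℕ.+ ∣ e ℤ.* Δa ∣         ≡⟨ cong (∣ Δu ∣ ℕ.+_) (ℤP.∣i*j∣≡∣i∣*∣j∣ e Δa) ⟩
    ∣ Δu ∣ ℕ.+ ∣ e ∣ ℕ.* ∣ Δa ∣     ≤⟨ ℕP.+-mono-≤ Δu≤w' (ℕP.*-monoʳ-≤ ∣ e ∣ Δa≤w) ⟩
    w' ℕ.+ ∣ e ∣ ℕ.* w              ∎)
  where
  open ℕP.≤-Reasoning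
  e = u₁ ℤ.- k ℤ.* u₂
  Δa = a₁ ℤ.- a₂
  Δu = (u₁ , u₂) · s ℤ.- (u₁ , u₂) · t
  Δf = (k , 1ℤ) · s ℤ.- (k , 1ℤ) · t
  split : ∀ u₁ u₂ k a₁ b₁ a₂ b₂ →
    u₂ ℤ.* ((k ℤ.* a₁ ℤ.+ 1ℤ ℤ.* b₁) ℤ.- (k ℤ.* a₂ ℤ.+ 1ℤ ℤ.* b₂))
      ≡ (u₁ ℤ.* a₁ ℤ.+ u₂ ℤ.* b₁) ℤ.- (u₁ ℤ.* a₂ ℤ.+ u₂ ℤ.* b₂) ℤ.- (u₁ ℤ.- k ℤ.* u₂) ℤ.* (a₁ ℤ.- a₂)
  split = solve-∀

module LatticePointsInP {u₁ u₂ : ℤ} {w w' : ℕ} {r : ℚ} {S : List ℤ²}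
         (S⊆P : ∀ x → InConv S x → InP (u₁ , u₂) w w' r x) where

  first-coordinate-bounded : ∀ {s} → s ∈ S → (0ℤ ℤ.≤ proj₁ s) × (proj₁ s ℤ.≤ + w)
  first-coordinate-bounded s∈S =
    let (0≤s₁ , s₁≤w , _ , _) = S⊆P _ (embed-∈-conv s∈S)
    in ι-cancel-≤ 0≤s₁ , ι-cancel-≤ s₁≤w

  strip-width : ∀ {s t} → s ∈ S → t ∈ S → ∣ (u₁ , u₂) · s ℤ.- (u₁ , u₂) · t ∣ ℕ.≤ w'
  strip-width {s} {t} s∈S t∈S = ∣i-j∣≤ (below s∈S t∈S) (below t∈S s∈S)
    where
    in-strip : ∀ {s} → s ∈ S → (r ℚ.≤ ι ((u₁ , u₂) · s)) × (ι ((u₁ , u₂) · s) ℚ.≤ r ℚ.+ ι (+ w'))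
    in-strip {s} s∈S =
      let (_ , _ , r≤us , us≤r+w') = S⊆P _ (embed-∈-conv s∈S)
      in subst (r ℚ.≤_) (sym (ι-homo-· u₁ u₂ s)) r≤us ,
         subst (ℚ._≤ r ℚ.+ ι (+ w')) (sym (ι-homo-· u₁ u₂ s)) us≤r+w'
    below : ∀ {s t} → s ∈ S → t ∈ S → (u₁ , u₂) · s ℤ.≤ (u₁ , u₂) · t ℤ.+ + w'
    below {s} {t} s∈S t∈S = ι-cancel-≤ (begin
      ι ((u₁ , u₂) · s)                  ≤⟨ proj₂ (in-strip s∈S) ⟩
      r ℚ.+ ι (+ w')                     ≤⟨ ℚP.+-monoˡ-≤ (ι (+ w')) (proj₁ (in-strip t∈S)) ⟩
      ι ((u₁ , u₂) · t) ℚ.+ ι (+ w')     ≡⟨ ι-homo-+ ((u₁ , u₂) · t) (+ w') ⟨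
      ι ((u₁ , u₂) · t ℤ.+ + w')         ∎)
      where open ℚP.≤-Reasoning

  sheared-width : ∀ {k s t} .{{_ : ℤ.NonZero u₂}} → 2 ℕ.* ∣ u₁ ℤ.- k ℤ.* u₂ ∣ ℕ.≤ ∣ u₂ ∣ →
    s ∈ S → t ∈ S → ∣ (k , 1ℤ) · s ℤ.- (k , 1ℤ) · t ∣ ℕ.≤ w ⊔ w'
  sheared-width {k} {s} {t} near s∈S t∈S = stripWidth u₁ u₂ k s t near
    (∣i-j∣≤-of-bounds (first-coordinate-bounded s∈S) (first-coordinate-bounded t∈S))
    (strip-width s∈S t∈S)

proposition2p1 : (u : ℤ²) → ¬ (proj₂ u ≡ + 0) → (w w' : ℕ) → NonZero w → NonZero w' → (r : ℚ)
    → (S : List ℤ²) → TwoDim S → (∀ x → InConv S x → InP u w w' r x)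
    → ∃[ A ] ∃[ c ] (InGL₂ℤ A × (∀ x → InConv S x → InBox w (w ⊔ w') (affine A c x)))
proposition2p1 (u₁ , u₂) u₂≢0 w w' _ _ r S (p , _ , _ , p∈S , _) S⊆P =
  mat 1ℤ 0ℤ k 1ℤ , (0ℤ , ℤ.- f t) , inj₁ refl , λ x x∈convS →
    let (0≤x₁ , x₁≤w) = integralForm-bounded-on-conv 1ℤ 0ℤ 0ℤ 0ℤ (+ w) first-coordinate x∈convS
        (0≤y , y≤M)   = integralForm-bounded-on-conv k 1ℤ (ℤ.- f t) 0ℤ (+ (w ⊔ w')) sheared x∈convS
    in 0≤x₁ , x₁≤w , 0≤y , y≤M
  where
  open LatticePointsInP {u₁} {u₂} {w} {w'} {r} {S} S⊆P
  instance
    u₂-nonZero : ℤ.NonZero u₂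
    u₂-nonZero = ℤ.≢-nonZero u₂≢0
  near = nearestMultiple u₁ u₂ u₂≢0
  k = proj₁ near
  f = (k , 1ℤ) ·_
  t = argmin f p S
  t∈S : t ∈ S
  t∈S = [ (λ t≡p → subst (_∈ S) (sym t≡p) p∈S) , id ]′ (argmin-sel f p S)
  first-coordinate : ∀ {s} → s ∈ S → (0ℤ ℤ.≤ (1ℤ , 0ℤ) · s ℤ.+ 0ℤ) × ((1ℤ , 0ℤ) · s ℤ.+ 0ℤ ℤ.≤ + w)
  first-coordinate {a , b} s∈S = subst (λ e → (0ℤ ℤ.≤ e) × (e ℤ.≤ + w)) (sym (projection a b))
    (first-coordinate-bounded s∈S)
    where
    projection : ∀ a b → 1ℤ ℤ.* a ℤ.+ 0ℤ ℤ.* b ℤ.+ 0ℤ ≡ a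
    projection = solve-∀
  sheared : ∀ {s} → s ∈ S → (0ℤ ℤ.≤ f s ℤ.- f t) × (f s ℤ.- f t ℤ.≤ + (w ⊔ w'))
  sheared {s} s∈S = 0≤Δf ,
    subst (ℤ._≤ + (w ⊔ w')) (ℤP.0≤i⇒+∣i∣≡i 0≤Δf) (+≤+ (sheared-width {k} (proj₂ near) s∈S t∈S))
    where
    0≤Δf : 0ℤ ℤ.≤ f s ℤ.- f t
    0≤Δf = ℤP.i≤j⇒0≤j-i (lookup (f[argmin]≤f[xs] {f = f} p S) s∈S)
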